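{- Let $A$ be a finite nonempty alphabet and $S\subset A^*$ a biextendable set. Let $w\in S$ and $U,V,T\subset S$. Let $\ell\in S\setminus U$ be such that $\ell w\in S$, and set $U'=(U\setminus T\ell)\cup\{\ell\}$. If the generalized extension graphs $E_{U',V}(w)$ and $E_{T,V}(\ell w)$ are acyclic, then $E_{U,V}(w)$ is acyclic.
   Context: $S$ is biextendable if it contains all factors of its elements and for every $w\in S$ there are letters $a,b$ with $awb\in S$. $T\ell=\{t\ell\mid t\in T\}$. For $w\in S$ and sets of words $U,V$, let $U(w)=\{u\in U\mid uw\in S\}$ and $V(w)=\{r\in V\mid wr\in S\}$; the generalized extension graph $E_{U,V}(w)$ is the undirected graph whose vertex set is the disjoint union of a copy of $U(w)$ and a copy of $V(w)$, with an edge $(u,r)$ for $u\in U(w)$, $r\in V(w)$ whenever $uwr\in S$. -}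

module Defs where

open import Data.Nat using (ℕ; suc; _≤_)
open import Data.Fin using (Fin)
open import Data.List using (List; []; _∷_; _++_; [_]; length)
open import Data.Sum using (_⊎_; inj₁; inj₂)
open import Data.Product using (_×_; ∃; ∃-syntax; Σ)
open import Data.Empty using (⊥)
open import Relation.Nullary using (¬_)
open import Relation.Binary.PropositionalEquality using (_≡_)
open import Data.List.Relation.Unary.Linked using (Linked)
open import Data.List.Relation.Unary.Unique.Propositional using (Unique)

Lang : Set → Set₁
Lang A = List A → Set

module _ {A : Set} where

  _⊆_ : Lang A → Lang A → Set
  X ⊆ Y = ∀ x → X x → Y x

  FactorClosed : Lang A → Set
  FactorClosed S = ∀ x y z → S (x ++ y ++ z) → S y

  Biextendable : Lang A → Set
  Biextendable S = FactorClosed S × (∀ w → S w → ∃[ a ] ∃[ b ] S (a ∷ w ++ [ b ]))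

  RightMul : Lang A → List A → Lang A
  RightMul T l x = ∃[ t ] (T t × x ≡ t ++ l)

  _∖_ : Lang A → Lang A → Lang A
  (X ∖ Y) x = X x × ¬ Y x

  _∪_ : Lang A → Lang A → Lang A
  (X ∪ Y) x = X x ⊎ Y x

  ｛_｝ : List A → Lang A
  ｛ l ｝ x = x ≡ l

  -- Vertices of a generalized extension graph: a copy of left words (inj₁)
  -- and a copy of right words (inj₂), disjoint union.
  Vertex : Set
  Vertex = List A ⊎ List A

  data ExtEdge (S U V : Lang A) (w : List A) : Vertex → Vertex → Set where
    lr : ∀ {u r} → U u → S (u ++ w) → V r → S (w ++ r) → S (u ++ w ++ r)
         → ExtEdge S U V w (inj₁ u) (inj₂ r)
    rl : ∀ {u r} → U u → S (u ++ w) → V r → S (w ++ r) → S (u ++ w ++ r)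
         → ExtEdge S U V w (inj₂ r) (inj₁ u)

  record Cycle (E : Vertex → Vertex → Set) : Set where
    field
      first  : Vertex
      rest   : List Vertex
      long   : 2 ≤ length rest
      distinct : Unique (first ∷ rest)
      closed : Linked E (first ∷ rest ++ [ first ])

  Acyclic : (Vertex → Vertex → Set) → Set
  Acyclic E = ¬ Cycle E

  AcyclicExt : (S U V : Lang A) (w : List A) → Set
  AcyclicExt S U V w = Acyclic (ExtEdge S U V w)

-- Call a left vertex u ∈ U of a cycle of E_{U,V}(w) bad if u ∈ Tℓ and good
-- otherwise.  A cycle without good vertices becomes a cycle of E_{T,V}(ℓw) once
-- the suffix ℓ is removed from every bad vertex, because (tℓ)wr = t(ℓw)r.  A
-- cycle without bad vertices is already a cycle of E_{U',V}(w).  Otherwise take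
-- a good vertex g, the last bad vertex b' before it and the first bad vertex b
-- after it: merging b' and b into ℓ closes the arc b' … g … b into a cycle
-- through ℓ of E_{U',V}(w), since by factoriality every edge tℓ — r gives an
-- edge ℓ — r.  Badness is not decidable, but the goal is ⊥, so the vertices
-- may be classified under double negation.
module Submission where

open import Defs
open import Data.Empty using (⊥)
open import Data.Fin using (Fin)
open import Data.List using (List; []; _∷_; _++_; [_]; length)
open import Data.List.Properties using (++-assoc; ++-identityʳ)
open import Data.List.Relation.Unary.All as All using (All; []; _∷_)
import Data.List.Relation.Unary.All.Properties as Allₚ
open import Data.List.Relation.Unary.AllPairs using ([]; _∷_)
open import Data.List.Relation.Unary.Linked using (Linked; []; [-]; _∷_)
open import Data.List.Relation.Unary.Unique.Propositional using (Unique)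
open import Data.List.Relation.Binary.Pointwise as Pointwise
  using (Pointwise; []; _∷_; Pointwise-length)
open import Data.List.Relation.Binary.Permutation.Propositional using (_↭_; ↭⇒↭ₛ)
open import Data.List.Relation.Binary.Permutation.Propositional.Properties
  using (++-comm; ↭-length; All-resp-↭)
import Data.List.Relation.Binary.Permutation.Setoid.Properties as Permutationₛ
open import Data.Nat using (ℕ; suc; _≤_; s≤s; z≤n)
open import Data.Nat.Properties using (suc-injective)
open import Data.Product as Product using (_×_; _,_; ∃; ∃-syntax; proj₁)
open import Data.Sum using (_⊎_; inj₁; inj₂)
open import Relation.Nullary using (¬_; Dec; yes; no)
open import Relation.Nullary.Decidable using (¬¬-excluded-middle)
open import Relation.Nullary.Negation using (¬¬-Monad; ¬¬-map)
open import Relation.Binary.PropositionalEquality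
  using (_≡_; _≢_; refl; sym; trans; cong; subst; setoid; module ≡-Reasoning)

module _ {X : Set} {P Q : X → Set} where

  split-at-first : ∀ {xs} → All (λ x → P x ⊎ Q x) xs →
    All P xs ⊎ ∃[ ys ] ∃[ z ] ∃[ zs ] (xs ≡ ys ++ z ∷ zs × All P ys × Q z)
  split-at-first [] = inj₁ []
  split-at-first (inj₂ qx ∷ _) = inj₂ ([] , _ , _ , refl , [] , qx)
  split-at-first (inj₁ px ∷ pqs) with split-at-first pqs
  ... | inj₁ ps = inj₁ (px ∷ ps)
  ... | inj₂ (ys , z , zs , refl , ps , qz) = inj₂ (_ ∷ ys , z , zs , refl , px ∷ ps , qz)

  split-at-first-∷ʳ : ∀ {xs y} → All (λ x → P x ⊎ Q x) xs → Q y →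
    ∃[ ys ] ∃[ z ] ∃[ zs ] (xs ++ [ y ] ≡ ys ++ z ∷ zs × All P ys × Q z)
  split-at-first-∷ʳ {y = y} pqs qy with split-at-first pqs
  ... | inj₁ ps = _ , _ , [] , refl , ps , qy
  ... | inj₂ (ys , z , zs , refl , ps , qz) =
    ys , z , zs ++ [ y ] , ++-assoc ys (z ∷ zs) [ y ] , ps , qz

  split-at-last : ∀ {xs} → All (λ x → P x ⊎ Q x) xs →
    All P xs ⊎ ∃[ ys ] ∃[ z ] ∃[ zs ] (xs ≡ ys ++ z ∷ zs × Q z × All P zs)
  split-at-last [] = inj₁ []
  split-at-last (pq ∷ pqs) with split-at-last pqs | pq
  ... | inj₂ (ys , z , zs , refl , qz , ps) | _ = inj₂ (_ ∷ ys , z , zs , refl , qz , ps)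
  ... | inj₁ ps | inj₁ px = inj₁ (px ∷ ps)
  ... | inj₁ ps | inj₂ qx = inj₂ ([] , _ , _ , refl , qx , ps)

module _ {X Y : Set} {Q : X → Y → Set} where

  Pointwise-choice : ∀ {xs} → All (λ x → ∃ (Q x)) xs → ∃ (Pointwise Q xs)
  Pointwise-choice [] = [] , []
  Pointwise-choice ((y , q) ∷ qs) = Product.map (y ∷_) (q ∷_) (Pointwise-choice qs)

  Unique-transport : (∀ {x y x′ y′} → Q x x′ → Q y y′ → x′ ≡ y′ → x ≡ y) →
                     ∀ {xs ys} → Pointwise Q xs ys → Unique xs → Unique ys
  Unique-transport injective [] [] = []
  Unique-transport injective (q ∷ qs) (x∉xs ∷ distinct) =
    distinct-image q qs x∉xs ∷ Unique-transport injective qs distinct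
    where
      distinct-image : ∀ {x x′ xs ys} → Q x x′ → Pointwise Q xs ys →
                       All (x ≢_) xs → All (x′ ≢_) ys
      distinct-image q [] [] = []
      distinct-image q (q′ ∷ qs) (x≢ ∷ x∉) =
        (λ eq → x≢ (injective q q′ eq)) ∷ distinct-image q qs x∉

  Linked-transport : ∀ {R : X → X → Set} {R′ : Y → Y → Set} →
                     (∀ {x y x′ y′} → R x y → Q x x′ → Q y y′ → R′ x′ y′) →
                     ∀ {xs ys} → Pointwise Q xs ys → Linked R xs → Linked R′ ys
  Linked-transport preserves [] [] = []
  Linked-transport preserves (_ ∷ []) [-] = [-]
  Linked-transport preserves (q ∷ q′ ∷ qs) (r ∷ rs) =
    preserves r q q′ ∷ Linked-transport preserves (q′ ∷ qs) rs

Pointwise-diagonal : ∀ {X : Set} {Q : X → X → Set} {xs} →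
                     All (λ x → Q x x) xs → Pointwise Q xs xs
Pointwise-diagonal [] = []
Pointwise-diagonal (q ∷ qs) = q ∷ Pointwise-diagonal qs

Unique-resp-↭ : ∀ {X : Set} {xs ys : List X} → xs ↭ ys → Unique xs → Unique ys
Unique-resp-↭ {X} p = Permutationₛ.Unique-resp-↭ (setoid X) (↭⇒↭ₛ p)

Unique-++⁻ˡ : ∀ {X : Set} (xs : List X) {ys} → Unique (xs ++ ys) → Unique xs
Unique-++⁻ˡ [] _ = []
Unique-++⁻ˡ (x ∷ xs) (x∉ ∷ distinct) = Allₚ.++⁻ˡ xs x∉ ∷ Unique-++⁻ˡ xs distinct

IsCycle : ∀ {X : Set} → (X → X → Set) → X → List X → Set
IsCycle R x xs = 2 ≤ length xs × Unique (x ∷ xs) × Linked R (x ∷ xs ++ [ x ])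

module _ {X : Set} {R : X → X → Set} where

  Linked-split : ∀ xs {y zs} → Linked R (xs ++ y ∷ zs) →
                 Linked R (xs ++ [ y ]) × Linked R (y ∷ zs)
  Linked-split [] rs = [-] , rs
  Linked-split (x ∷ []) (r ∷ rs) = r ∷ [-] , rs
  Linked-split (x ∷ x′ ∷ xs) (r ∷ rs) = Product.map₁ (r ∷_) (Linked-split (x′ ∷ xs) rs)

  Linked-glue : ∀ xs {y zs} → Linked R (xs ++ [ y ]) → Linked R (y ∷ zs) →
                Linked R (xs ++ y ∷ zs)
  Linked-glue [] _ rs = rs
  Linked-glue (x ∷ []) (r ∷ [-]) rs = r ∷ rs
  Linked-glue (x ∷ x′ ∷ xs) (r ∷ rs′) rs = r ∷ Linked-glue (x′ ∷ xs) rs′ rs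

  Linked-sources : ∀ xs {y} → Linked R (xs ++ [ y ]) → All (λ x → ∃ (R x)) xs
  Linked-sources [] _ = []
  Linked-sources (x ∷ []) (r ∷ _) = (_ , r) ∷ []
  Linked-sources (x ∷ x′ ∷ xs) (r ∷ rs) = (_ , r) ∷ Linked-sources (x′ ∷ xs) rs

  Linked-rotate : ∀ x ys y zs → Linked R (x ∷ (ys ++ y ∷ zs) ++ [ x ]) →
                  Linked R (y ∷ (zs ++ x ∷ ys) ++ [ y ])
  Linked-rotate x ys y zs closed
    with Linked-split (x ∷ ys)
           (subst (λ vs → Linked R (x ∷ vs)) (++-assoc ys (y ∷ zs) [ x ]) closed)
  ... | x-to-y , y-to-x =
    subst (λ vs → Linked R (y ∷ vs)) (sym (++-assoc zs (x ∷ ys) [ y ]))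
      (Linked-glue (y ∷ zs) y-to-x x-to-y)

  rotate : ∀ ys {x xs y zs} → x ∷ xs ≡ ys ++ y ∷ zs → IsCycle R x xs → IsCycle R y (zs ++ ys)
  rotate [] {xs = xs} refl cyc = subst (IsCycle R _) (sym (++-identityʳ xs)) cyc
  rotate (x ∷ ys) {y = y} {zs} refl (long , distinct , closed) =
    subst (2 ≤_) (suc-injective (↭-length turn)) long ,
    Unique-resp-↭ turn distinct ,
    Linked-rotate x ys y zs closed
    where
      turn : x ∷ ys ++ y ∷ zs ↭ y ∷ zs ++ x ∷ ys
      turn = ++-comm (x ∷ ys) (y ∷ zs)

  IsCycle-transport : ∀ {Y : Set} {R′ : Y → Y → Set} {Q : X → Y → Set} →
    (∀ {x y x′ y′} → Q x x′ → Q y y′ → x′ ≡ y′ → x ≡ y) →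
    (∀ {x y x′ y′} → R x y → Q x x′ → Q y y′ → R′ x′ y′) →
    ∀ {x xs y ys} → Pointwise Q (x ∷ xs) (y ∷ ys) → IsCycle R x xs → IsCycle R′ y ys
  IsCycle-transport injective preserves q∷qs@(q ∷ qs) (long , distinct , closed) =
    subst (2 ≤_) (Pointwise-length qs) long ,
    Unique-transport injective q∷qs distinct ,
    Linked-transport preserves (Pointwise.++⁺ q∷qs (q ∷ [])) closed

module _ {A : Set} {E : Vertex {A} → Vertex {A} → Set} where

  Cycle⇒IsCycle : (c : Cycle E) → IsCycle E (Cycle.first c) (Cycle.rest c)
  Cycle⇒IsCycle c = Cycle.long c , Cycle.distinct c , Cycle.closed c

  IsCycle⇒Cycle : ∀ {x xs} → IsCycle E x xs → Cycle E
  IsCycle⇒Cycle {x} {xs} (long , distinct , closed) = record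
    { first = x ; rest = xs ; long = long ; distinct = distinct ; closed = closed }

module _ {A : Set} {S U V : Lang A} {w : List A} where

  ExtEdge-sym : ∀ {x y} → ExtEdge S U V w x y → ExtEdge S U V w y x
  ExtEdge-sym (lr Uu Suw Vr Swr Suwr) = rl Uu Suw Vr Swr Suwr
  ExtEdge-sym (rl Uu Suw Vr Swr Suwr) = lr Uu Suw Vr Swr Suwr

factor-suffix : ∀ {A : Set} {S : Lang A} → FactorClosed S → ∀ x y → S (x ++ y) → S y
factor-suffix {S = S} factorial x y Sxy =
  factorial x y [] (subst S (cong (x ++_) (sym (++-identityʳ y))) Sxy)

data IsRight {A : Set} : Vertex {A} → Set where
  right : ∀ r → IsRight (inj₂ r)

module _ {A : Set} (S U V T : Lang A) (w l : List A) where

  U′ : Lang A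
  U′ = (U ∖ RightMul T l) ∪ ｛ l ｝

  data Good : Vertex {A} → Set where
    good : ∀ {u} → U u → ¬ RightMul T l u → Good (inj₁ u)

  data Bad : Vertex {A} → Set where
    bad : ∀ {t} → T t → Bad (inj₁ (t ++ l))

  NonBad : Vertex {A} → Set
  NonBad v = IsRight v ⊎ Good v

  Kind : Vertex {A} → Set
  Kind v = NonBad v ⊎ Bad v

  data Collapse : Vertex {A} → Vertex {A} → Set where
    keep  : ∀ {v} → NonBad v → Collapse v v
    merge : ∀ {v} → Bad v → Collapse v (inj₁ l)

  data Unshift : Vertex {A} → Vertex {A} → Set where
    right : ∀ r → Unshift (inj₂ r) (inj₂ r)
    strip : ∀ {t} → T t → Unshift (inj₁ (t ++ l)) (inj₁ t)

  Shiftable : Vertex {A} → Set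
  Shiftable v = ∃ (Unshift v)

  shiftable-or-good : ∀ {v} → Kind v → Shiftable v ⊎ Good v
  shiftable-or-good (inj₁ (inj₁ (right r))) = inj₁ (_ , right r)
  shiftable-or-good (inj₁ (inj₂ good-v)) = inj₂ good-v
  shiftable-or-good (inj₂ (bad Tt)) = inj₁ (_ , strip Tt)

  unshift-injective : ∀ {x y x′ y′} → Unshift x x′ → Unshift y y′ → x′ ≡ y′ → x ≡ y
  unshift-injective (right _) (right _) refl = refl
  unshift-injective (strip _) (strip _) refl = refl
  unshift-injective (right _) (strip _) ()
  unshift-injective (strip _) (right _) ()

  left-kind : ∀ {u} → U u → Dec (RightMul T l u) → Kind (inj₁ u)
  left-kind _ (yes (_ , Tt , refl)) = inj₂ (bad Tt)
  left-kind Uu (no u∉Tℓ) = inj₁ (inj₂ (good Uu u∉Tℓ))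

  vertex-kind : ∀ {v v′} → ExtEdge S U V w v v′ → ¬ ¬ Kind v
  vertex-kind (lr Uu _ _ _ _) = ¬¬-map (left-kind Uu) ¬¬-excluded-middle
  vertex-kind (rl _ _ _ _ _) ¬kind = ¬kind (inj₁ (inj₁ (right _)))

  cycle-kinds : ∀ {f rest} → IsCycle (ExtEdge S U V w) f rest → ¬ ¬ All Kind (f ∷ rest)
  cycle-kinds {f} {rest} (_ , _ , closed) =
    All.mapM _ ¬¬-Monad (λ (_ , e) → vertex-kind e) (Linked-sources (f ∷ rest) closed)

  module _ (factorial : FactorClosed S) (lw∈S : S (l ++ w)) (l∉U : ¬ U l) where

    drop-prefix : ∀ t z → S ((t ++ l) ++ z) → S (l ++ z)
    drop-prefix t z Stlz = factor-suffix factorial t (l ++ z) (subst S (++-assoc t l z) Stlz)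

    collapse-lr : ∀ {u r x′ y′} → ExtEdge S U V w (inj₁ u) (inj₂ r) →
                  Collapse (inj₁ u) x′ → Collapse (inj₂ r) y′ → ExtEdge S U′ V w x′ y′
    collapse-lr (lr Uu Suw Vr Swr Suwr) (keep (inj₂ (good _ u∉Tℓ))) (keep _) =
      lr (inj₁ (Uu , u∉Tℓ)) Suw Vr Swr Suwr
    collapse-lr (lr {r = r} _ _ Vr Swr Stlwr) (merge (bad {t} _)) (keep _) =
      lr (inj₂ refl) lw∈S Vr Swr (drop-prefix t (w ++ r) Stlwr)
    collapse-lr _ (keep (inj₁ ())) _
    collapse-lr _ _ (merge ())

    collapse-edge : ∀ {x y x′ y′} → ExtEdge S U V w x y →
                    Collapse x x′ → Collapse y y′ → ExtEdge S U′ V w x′ y′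
    collapse-edge e@(lr _ _ _ _ _) cx cy = collapse-lr e cx cy
    collapse-edge e@(rl _ _ _ _ _) cx cy = ExtEdge-sym (collapse-lr (ExtEdge-sym e) cy cx)

    unshift-lr : ∀ {u r x′ y′} → ExtEdge S U V w (inj₁ u) (inj₂ r) →
                 Unshift (inj₁ u) x′ → Unshift (inj₂ r) y′ → ExtEdge S T V (l ++ w) x′ y′
    unshift-lr (lr {r = r} _ Stlw Vr _ Stlwr) (strip {t} Tt) (right _) =
      lr Tt (subst S (++-assoc t l w) Stlw) Vr (factor-suffix factorial t _ Stlwr′) Stlwr′
      where
        Stlwr′ : S (t ++ (l ++ w) ++ r)
        Stlwr′ = subst S (trans (++-assoc t l (w ++ r)) (cong (t ++_) (sym (++-assoc l w r))))
                   Stlwr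

    unshift-edge : ∀ {x y x′ y′} → ExtEdge S U V w x y →
                   Unshift x x′ → Unshift y y′ → ExtEdge S T V (l ++ w) x′ y′
    unshift-edge e@(lr _ _ _ _ _) ux uy = unshift-lr e ux uy
    unshift-edge e@(rl _ _ _ _ _) ux uy = ExtEdge-sym (unshift-lr (ExtEdge-sym e) uy ux)

    ℓ≢nonBad : ∀ {v} → NonBad v → inj₁ l ≢ v
    ℓ≢nonBad (inj₁ (right _)) ()
    ℓ≢nonBad (inj₂ (good Uu _)) refl = l∉U Uu

    unshifted-cycle : ∀ {f rest} → IsCycle (ExtEdge S U V w) f rest →
                      All Shiftable (f ∷ rest) → Cycle (ExtEdge S T V (l ++ w))
    unshifted-cycle cyc shiftable with Pointwise-choice shiftable
    ... | _ ∷ _ , unshifts =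
      IsCycle⇒Cycle (IsCycle-transport unshift-injective unshift-edge unshifts cyc)

    kept-cycle : ∀ {f rest} → IsCycle (ExtEdge S U V w) f rest →
                 All NonBad (f ∷ rest) → Cycle (ExtEdge S U′ V w)
    kept-cycle (long , distinct , closed) nonBad@(nonBad-f ∷ _) =
      IsCycle⇒Cycle (long , distinct ,
        Linked-transport collapse-edge
          (Pointwise-diagonal (All.map keep (Allₚ.++⁺ nonBad (nonBad-f ∷ [])))) closed)

    contract : ∀ {b′ b arc} → Bad b′ → Bad b → All NonBad arc → 2 ≤ length arc →
               Unique arc → Linked (ExtEdge S U V w) (b′ ∷ arc ++ [ b ]) →
               Cycle (ExtEdge S U′ V w)
    contract bad-b′ bad-b nonBad long distinct walk =
      IsCycle⇒Cycle (long , All.map ℓ≢nonBad nonBad ∷ distinct ,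
        Linked-transport collapse-edge
          (merge bad-b′ ∷ Pointwise.++⁺ (Pointwise-diagonal (All.map keep nonBad))
                                        (merge bad-b ∷ []))
          walk)

    arc-long : ∀ {b′ g} → Bad b′ → Good g → ∀ Q {ys zs} →
               Linked (ExtEdge S U V w) (b′ ∷ (Q ++ g ∷ ys) ++ zs) → 2 ≤ length (Q ++ g ∷ ys)
    arc-long (bad _) (good _ _) [] (() ∷ _)
    arc-long _ _ (_ ∷ []) _ = s≤s (s≤s z≤n)
    arc-long _ _ (_ ∷ _ ∷ _) _ = s≤s (s≤s z≤n)

    -- The arc ends at the first bad vertex after g, which may be b′ itself.
    contracted-cycle : ∀ {b′ g} Q X → Bad b′ → All NonBad Q → Good g → All Kind X →
                       IsCycle (ExtEdge S U V w) b′ (Q ++ g ∷ X) → Cycle (ExtEdge S U′ V w)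
    contracted-cycle {b′} {g} Q X bad-b′ nonBad-Q good-g kinds-X (_ , distinct , closed)
      with split-at-first-∷ʳ kinds-X bad-b′
    ... | N , b , M , X∷b′≡N∷b∷M , nonBad-N , bad-b =
      contract bad-b′ bad-b (Allₚ.++⁺ nonBad-Q (inj₂ good-g ∷ nonBad-N))
        (arc-long bad-b′ good-g Q walk) (Unique-++⁻ˡ (Q ++ g ∷ N) distinct′) walk
      where
        open ≡-Reasoning
        unfold : (Q ++ g ∷ X) ++ [ b′ ] ≡ (Q ++ g ∷ N) ++ b ∷ M
        unfold = begin
          (Q ++ g ∷ X) ++ [ b′ ]  ≡⟨ ++-assoc Q (g ∷ X) [ b′ ] ⟩
          Q ++ g ∷ X ++ [ b′ ]    ≡⟨ cong (λ zs → Q ++ g ∷ zs) X∷b′≡N∷b∷M ⟩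
          Q ++ g ∷ N ++ b ∷ M     ≡⟨ sym (++-assoc Q (g ∷ N) (b ∷ M)) ⟩
          (Q ++ g ∷ N) ++ b ∷ M   ∎
        walk : Linked (ExtEdge S U V w) (b′ ∷ (Q ++ g ∷ N) ++ [ b ])
        walk = proj₁ (Linked-split (b′ ∷ Q ++ g ∷ N)
                 (subst (λ zs → Linked (ExtEdge S U V w) (b′ ∷ zs)) unfold closed))
        distinct′ : Unique ((Q ++ g ∷ N) ++ b ∷ M)
        distinct′ = subst Unique unfold (Unique-resp-↭ (++-comm [ b′ ] (Q ++ g ∷ X)) distinct)

    module _ (acyclic′ : AcyclicExt S U′ V w) (acyclicᵀ : AcyclicExt S T V (l ++ w)) where

      no-cycle-through-good : ∀ {g rest} → Good g → IsCycle (ExtEdge S U V w) g rest →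
                              All Kind rest → ⊥
      no-cycle-through-good {g} good-g cyc kinds with split-at-last kinds
      ... | inj₁ nonBad = acyclic′ (kept-cycle cyc (inj₂ good-g ∷ nonBad))
      ... | inj₂ (X , b′ , Q , refl , bad-b′ , nonBad-Q) =
        acyclic′ (contracted-cycle Q X bad-b′ nonBad-Q good-g (Allₚ.++⁻ˡ X kinds)
                   (rotate (g ∷ X) refl cyc))

      no-classified-cycle : ∀ {f rest} → IsCycle (ExtEdge S U V w) f rest →
                            All Kind (f ∷ rest) → ⊥
      no-classified-cycle cyc kinds with split-at-first (All.map shiftable-or-good kinds)
      ... | inj₁ shiftable = acyclicᵀ (unshifted-cycle cyc shiftable)
      ... | inj₂ (pre , g , post , split , _ , good-g) =
        no-cycle-through-good good-g (rotate pre split cyc)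
          (All.tail (All-resp-↭ (++-comm pre (g ∷ post)) (subst (All Kind) split kinds)))

      acyclic-by-contraction : AcyclicExt S U V w
      acyclic-by-contraction c =
        cycle-kinds (Cycle⇒IsCycle c) (no-classified-cycle (Cycle⇒IsCycle c))

lemma3p8 : (k : ℕ) (S : Lang (Fin (suc k))) → Biextendable S →
    (w : List (Fin (suc k))) → S w →
    (U V T : Lang (Fin (suc k))) → U ⊆ S → V ⊆ S → T ⊆ S →
    (l : List (Fin (suc k))) → S l → ¬ U l → S (l ++ w) →
    AcyclicExt S ((U ∖ RightMul T l) ∪ ｛ l ｝) V w →
    AcyclicExt S T V (l ++ w) →
    AcyclicExt S U V w
lemma3p8 k S (factorial , _) w _ U V T _ _ _ l _ l∉U lw∈S acyclic′ acyclicᵀ =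
  acyclic-by-contraction S U V T w l factorial lw∈S l∉U acyclic′ acyclicᵀ
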